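{- Let $m$ be a positive integer, let $s=(-1)^m$, and let $S$ be the $s$-symmetrization operator. Let $f$ and $g$ be LPs of lengths $n$ and $\delta$ respectively, and define the LPs $$f_1=f\lor g,\qquad f_2=f\lor g\lor (s\,g^*)$$ of lengths $n+\delta$ and $n+2\delta$. If $S(f)\in\mathcal{P}(2n,m)$ and $S(f_1)\in\mathcal{P}(2n+2\delta,m)$, then $S(f_2)\in\mathcal{P}(2n+4\delta,m)$.
   Context: A Littlewood polynomial (LP) of length $n$ is a polynomial $f(x)=\sum_{i=0}^{n-1}a_ix^i$ with every $a_i\in\{1,-1\}$; its length is denoted $\ell(f)=n$. An LP has order $m$ if $(x-1)^m$ divides it; $\mathcal{P}(n,m)$ is the set of LPs of length $n$ and order $m$. The join of LPs $f,g$ is $(f\lor g)(x)=f(x)+x^{\ell(f)}g(x)$, an LP of length $\ell(f)+\ell(g)$ (the join is associative). The reversal of an LP $f$ is $f^*(x)=x^{\ell(f)-1}f(1/x)$. For $s\in\{1,-1\}$, the $s$-symmetrization of an LP $f$ is $S(f)=f\lor(s f^*)$. -}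

module Defs where

open import Data.Nat using (ℕ; zero; suc)
open import Data.Integer using (ℤ; +_; -_) renaming (_+_ to _+ℤ_; _*_ to _*ℤ_)
open import Data.List using (List; []; _∷_; _++_; map; reverse; length)
open import Data.Sign using (Sign) renaming (_*_ to _*ˢ_)
import Data.Sign as Sign
open import Data.Product using (∃; _×_)
open import Relation.Binary.PropositionalEquality using (_≡_)

-- Integer polynomials as coefficient lists (constant term first).
Poly : Set
Poly = List ℤ

coeff : Poly → ℕ → ℤ
coeff []       _       = + 0
coeff (a ∷ p)  zero    = a
coeff (a ∷ p)  (suc i) = coeff p i

addP : Poly → Poly → Poly
addP []       q        = q
addP p        []       = p
addP (a ∷ p)  (b ∷ q)  = (a +ℤ b) ∷ addP p q

scaleP : ℤ → Poly → Poly
scaleP c = map (c *ℤ_)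

mulP : Poly → Poly → Poly
mulP []       q = []
mulP (a ∷ p)  q = addP (scaleP a q) (+ 0 ∷ mulP p q)

xm1pow : ℕ → Poly
xm1pow zero    = + 1 ∷ []
xm1pow (suc m) = mulP (- (+ 1) ∷ + 1 ∷ []) (xm1pow m)

_∣P_ : Poly → Poly → Set
d ∣P p = ∃ λ (q : Poly) → ∀ i → coeff (mulP d q) i ≡ coeff p i

-- Littlewood polynomials: coefficient sequences a_0 … a_{n-1} with a_i ∈ {1,-1}
LP : Set
LP = List Sign

toPoly : LP → Poly
toPoly = map (λ { Sign.+ → + 1 ; Sign.- → - (+ 1) })

ℓ : LP → ℕ
ℓ = length

-- join: (f ∨ g)(x) = f(x) + x^{ℓ(f)} g(x), i.e. concatenation of coefficient sequences
_∨_ : LP → LP → LP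
f ∨ g = f ++ g
infixr 5 _∨_

-- reversal: f*(x) = x^{ℓ(f)-1} f(1/x)
rev : LP → LP
rev = reverse

_·_ : Sign → LP → LP
s · f = map (s *ˢ_) f
infixr 6 _·_

Sym : Sign → LP → LP
Sym s f = f ∨ (s · rev f)

HasOrder : ℕ → LP → Set
HasOrder m f = xm1pow m ∣P toPoly f

_∈𝒫[_,_] : LP → ℕ → ℕ → Set
f ∈𝒫[ n , m ] = (ℓ f ≡ n) × HasOrder m f

negPow : ℕ → Sign
negPow zero    = Sign.+
negPow (suc m) = Sign.- *ˢ negPow m

-- Put u = S(g) = g ∨ s g*, so that f₂ = f ∨ u and s u* = u.  Then S(f) = f ∨ s f*,
-- S(f₁) = f ∨ u ∨ s f* and S(f₂) = f ∨ u ∨ u ∨ s f*, and with e = ℓ(u) = 2δ this gives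
-- S(f₂) + x^e S(f) = (1 + x^e) S(f₁); so (x − 1)^m divides S(f₂) once it divides S(f) and S(f₁).
module Submission where

open import Defs
open import Data.Sign using (Sign)
open import Data.Nat using (ℕ; zero; suc; _+_; _*_; _≥_)
open import Data.Nat.Properties using (+-comm)
import Data.Nat.Tactic.RingSolver as ℕ-Solver
open import Data.Integer using (ℤ; 0ℤ; -1ℤ) renaming (_+_ to _+ℤ_; _*_ to _*ℤ_)
import Data.Integer.Properties as ℤ
open import Data.Integer.Tactic.RingSolver using (solve-∀)
open import Data.List using ([]; _∷_; _++_; map; replicate)
open import Data.List.Properties
  using (++-assoc; map-++; map-∘; map-cong; map-id; reverse-++; reverse-map; reverse-involutive;
         length-++; length-map; length-reverse)
import Data.Sign as Sign
import Data.Sign.Properties as Sign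
open import Data.Product using (∃; _,_)
open import Function using (_∘_)
open import Relation.Binary.PropositionalEquality
  using (_≡_; refl; sym; trans; cong; cong₂; _≗_; module ≡-Reasoning)
open ≡-Reasoning

Seq : Set
Seq = ℕ → ℤ

infixl 6 _⊕_
infixr 7 _⊙_

_⊕_ : Seq → Seq → Seq
(φ ⊕ ψ) i = φ i +ℤ ψ i

_⊙_ : ℤ → Seq → Seq
(c ⊙ φ) i = c *ℤ φ i

⊕-cong : ∀ {φ φ′ ψ ψ′} → φ ≗ φ′ → ψ ≗ ψ′ → φ ⊕ ψ ≗ φ′ ⊕ ψ′
⊕-cong φ≗φ′ ψ≗ψ′ i = cong₂ _+ℤ_ (φ≗φ′ i) (ψ≗ψ′ i)

shift : ℕ → Seq → Seq
shift zero    φ i       = φ i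
shift (suc k) φ zero    = 0ℤ
shift (suc k) φ (suc i) = shift k φ i

shift-cong : ∀ k {φ ψ} → φ ≗ ψ → shift k φ ≗ shift k ψ
shift-cong zero    φ≗ψ i       = φ≗ψ i
shift-cong (suc k) φ≗ψ zero    = refl
shift-cong (suc k) φ≗ψ (suc i) = shift-cong k φ≗ψ i

shift-⊕ : ∀ k φ ψ → shift k (φ ⊕ ψ) ≗ shift k φ ⊕ shift k ψ
shift-⊕ zero    φ ψ i       = refl
shift-⊕ (suc k) φ ψ zero    = refl
shift-⊕ (suc k) φ ψ (suc i) = shift-⊕ k φ ψ i

shift-⊙ : ∀ k c φ → shift k (c ⊙ φ) ≗ c ⊙ shift k φ
shift-⊙ zero    c φ i       = refl
shift-⊙ (suc k) c φ zero    = sym (ℤ.*-zeroʳ c)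
shift-⊙ (suc k) c φ (suc i) = shift-⊙ k c φ i

shift-zero : ∀ k → shift k (λ _ → 0ℤ) ≗ (λ _ → 0ℤ)
shift-zero zero    i       = refl
shift-zero (suc k) zero    = refl
shift-zero (suc k) (suc i) = shift-zero k i

shift-shift : ∀ k l φ → shift k (shift l φ) ≗ shift (k + l) φ
shift-shift zero    l φ i       = refl
shift-shift (suc k) l φ zero    = refl
shift-shift (suc k) l φ (suc i) = shift-shift k l φ i

shift-comm : ∀ k l φ → shift k (shift l φ) ≗ shift l (shift k φ)
shift-comm k l φ i = begin
  shift k (shift l φ) i  ≡⟨ shift-shift k l φ i ⟩
  shift (k + l) φ i      ≡⟨ cong (λ j → shift j φ i) (+-comm k l) ⟩
  shift (l + k) φ i      ≡⟨ shift-shift l k φ i ⟨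
  shift l (shift k φ) i  ∎

-- With P, U, K the coefficients of p, u, k this is the identity
-- (p ∨ u ∨ u ∨ k) + x^e (p ∨ k) = (1 + x^e) (p ∨ u ∨ k), where a = ℓ p and e = ℓ u.
shift-telescope : ∀ a e P U K →
  P ⊕ shift a (U ⊕ shift e (U ⊕ shift e K)) ⊕ shift e (P ⊕ shift a K)
    ≗ P ⊕ shift a (U ⊕ shift e K) ⊕ shift e (P ⊕ shift a (U ⊕ shift e K))
shift-telescope a e P U K i = begin
  P i +ℤ shift a (U ⊕ shift e (U ⊕ Kₑ)) i +ℤ shift e (P ⊕ Kₐ) i
    ≡⟨ cong₂ (λ x y → P i +ℤ x +ℤ y) expandˡ (shift-⊕ e P Kₐ i) ⟩
  P i +ℤ (Uₐ i +ℤ (shift a Uₑ i +ℤ shift a (shift e Kₑ) i)) +ℤ (Pₑ i +ℤ shift e Kₐ i)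
    ≡⟨ cong₂ (λ x y → P i +ℤ (Uₐ i +ℤ (x +ℤ y)) +ℤ (Pₑ i +ℤ shift e Kₐ i))
             (shift-comm a e U i) (shift-comm a e Kₑ i) ⟩
  P i +ℤ (Uₐ i +ℤ (shift e Uₐ i +ℤ shift e Kₑₐ i)) +ℤ (Pₑ i +ℤ shift e Kₐ i)
    ≡⟨ cong (λ x → P i +ℤ (Uₐ i +ℤ (shift e Uₐ i +ℤ shift e Kₑₐ i)) +ℤ (Pₑ i +ℤ x))
            (shift-comm e a K i) ⟩
  P i +ℤ (Uₐ i +ℤ (shift e Uₐ i +ℤ shift e Kₑₐ i)) +ℤ (Pₑ i +ℤ Kₑₐ i)
    ≡⟨ rearrange (P i) (Uₐ i) (shift e Uₐ i) (shift e Kₑₐ i) (Pₑ i) (Kₑₐ i) ⟩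
  P i +ℤ (Uₐ i +ℤ Kₑₐ i) +ℤ (Pₑ i +ℤ (shift e Uₐ i +ℤ shift e Kₑₐ i))
    ≡⟨ cong₂ (λ x y → P i +ℤ x +ℤ y) (shift-⊕ a U Kₑ i) expandʳ ⟨
  P i +ℤ shift a (U ⊕ Kₑ) i +ℤ shift e (P ⊕ shift a (U ⊕ Kₑ)) i ∎
  where
  Kₑ  = shift e K
  Kₐ  = shift a K
  Kₑₐ = shift a Kₑ
  Uₐ  = shift a U
  Uₑ  = shift e U
  Pₑ  = shift e P
  expandˡ : shift a (U ⊕ shift e (U ⊕ Kₑ)) i ≡ Uₐ i +ℤ (shift a Uₑ i +ℤ shift a (shift e Kₑ) i)
  expandˡ = trans (shift-⊕ a U _ i)
                  (cong (Uₐ i +ℤ_) (trans (shift-cong a (shift-⊕ e U Kₑ) i) (shift-⊕ a Uₑ _ i)))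
  expandʳ : shift e (P ⊕ shift a (U ⊕ Kₑ)) i ≡ Pₑ i +ℤ (shift e Uₐ i +ℤ shift e Kₑₐ i)
  expandʳ = trans (shift-⊕ e P _ i)
                  (cong (Pₑ i +ℤ_) (trans (shift-cong e (shift-⊕ a U Kₑ) i) (shift-⊕ e Uₐ Kₑₐ i)))
  rearrange : ∀ p u uₑ kₑ pₑ k →
    p +ℤ (u +ℤ (uₑ +ℤ kₑ)) +ℤ (pₑ +ℤ k) ≡ p +ℤ (u +ℤ k) +ℤ (pₑ +ℤ (uₑ +ℤ kₑ))
  rearrange = solve-∀

conv : Poly → Seq → Seq
conv []      φ i = 0ℤ
conv (a ∷ d) φ i = (a ⊙ φ ⊕ shift 1 (conv d φ)) i

conv-cong : ∀ d {φ ψ} → φ ≗ ψ → conv d φ ≗ conv d ψ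
conv-cong []      φ≗ψ i = refl
conv-cong (a ∷ d) φ≗ψ i = cong₂ _+ℤ_ (cong (a *ℤ_) (φ≗ψ i)) (shift-cong 1 (conv-cong d φ≗ψ) i)

conv-⊕ : ∀ d φ ψ → conv d (φ ⊕ ψ) ≗ conv d φ ⊕ conv d ψ
conv-⊕ []      φ ψ i = refl
conv-⊕ (a ∷ d) φ ψ i = begin
  a *ℤ (φ i +ℤ ψ i) +ℤ shift 1 (conv d (φ ⊕ ψ)) i
    ≡⟨ cong (a *ℤ (φ i +ℤ ψ i) +ℤ_)
            (trans (shift-cong 1 (conv-⊕ d φ ψ) i) (shift-⊕ 1 (conv d φ) (conv d ψ) i)) ⟩
  a *ℤ (φ i +ℤ ψ i) +ℤ (shift 1 (conv d φ) i +ℤ shift 1 (conv d ψ) i)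
    ≡⟨ distrib a (φ i) (ψ i) _ _ ⟩
  a *ℤ φ i +ℤ shift 1 (conv d φ) i +ℤ (a *ℤ ψ i +ℤ shift 1 (conv d ψ) i) ∎
  where
  distrib : ∀ a x y u v → a *ℤ (x +ℤ y) +ℤ (u +ℤ v) ≡ a *ℤ x +ℤ u +ℤ (a *ℤ y +ℤ v)
  distrib = solve-∀

conv-⊙ : ∀ d c φ → conv d (c ⊙ φ) ≗ c ⊙ conv d φ
conv-⊙ []      c φ i = sym (ℤ.*-zeroʳ c)
conv-⊙ (a ∷ d) c φ i = begin
  a *ℤ (c *ℤ φ i) +ℤ shift 1 (conv d (c ⊙ φ)) i
    ≡⟨ cong (a *ℤ (c *ℤ φ i) +ℤ_)
            (trans (shift-cong 1 (conv-⊙ d c φ) i) (shift-⊙ 1 c (conv d φ) i)) ⟩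
  a *ℤ (c *ℤ φ i) +ℤ c *ℤ shift 1 (conv d φ) i
    ≡⟨ factor a c (φ i) _ ⟩
  c *ℤ (a *ℤ φ i +ℤ shift 1 (conv d φ) i) ∎
  where
  factor : ∀ a c x u → a *ℤ (c *ℤ x) +ℤ c *ℤ u ≡ c *ℤ (a *ℤ x +ℤ u)
  factor = solve-∀

conv-shift : ∀ d k φ → conv d (shift k φ) ≗ shift k (conv d φ)
conv-shift []      k φ i = sym (shift-zero k i)
conv-shift (a ∷ d) k φ i = begin
  a *ℤ shift k φ i +ℤ shift 1 (conv d (shift k φ)) i
    ≡⟨ cong₂ _+ℤ_ (sym (shift-⊙ k a φ i))
                  (trans (shift-cong 1 (conv-shift d k φ) i) (shift-comm 1 k (conv d φ) i)) ⟩
  shift k (a ⊙ φ) i +ℤ shift k (shift 1 (conv d φ)) i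
    ≡⟨ shift-⊕ k (a ⊙ φ) (shift 1 (conv d φ)) i ⟨
  shift k (conv (a ∷ d) φ) i ∎

coeff-addP : ∀ p q → coeff (addP p q) ≗ coeff p ⊕ coeff q
coeff-addP []      q       i       = sym (ℤ.+-identityˡ _)
coeff-addP (a ∷ p) []      i       = sym (ℤ.+-identityʳ _)
coeff-addP (a ∷ p) (b ∷ q) zero    = refl
coeff-addP (a ∷ p) (b ∷ q) (suc i) = coeff-addP p q i

coeff-scaleP : ∀ c p → coeff (scaleP c p) ≗ c ⊙ coeff p
coeff-scaleP c []      i       = sym (ℤ.*-zeroʳ c)
coeff-scaleP c (a ∷ p) zero    = refl
coeff-scaleP c (a ∷ p) (suc i) = coeff-scaleP c p i

coeff-zeros-++ : ∀ k p → coeff (replicate k 0ℤ ++ p) ≗ shift k (coeff p)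
coeff-zeros-++ zero    p i       = refl
coeff-zeros-++ (suc k) p zero    = refl
coeff-zeros-++ (suc k) p (suc i) = coeff-zeros-++ k p i

coeff-mulP : ∀ d q → coeff (mulP d q) ≗ conv d (coeff q)
coeff-mulP []      q i = refl
coeff-mulP (a ∷ d) q i = begin
  coeff (addP (scaleP a q) (0ℤ ∷ mulP d q)) i
    ≡⟨ coeff-addP (scaleP a q) (0ℤ ∷ mulP d q) i ⟩
  coeff (scaleP a q) i +ℤ coeff (0ℤ ∷ mulP d q) i
    ≡⟨ cong₂ _+ℤ_ (coeff-scaleP a q i)
                  (trans (coeff-zeros-++ 1 (mulP d q) i) (shift-cong 1 (coeff-mulP d q) i)) ⟩
  conv (a ∷ d) (coeff q) i ∎

-- d ∣P p is definitionally d ∣ˢ coeff p.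

infix 4 _∣ˢ_

_∣ˢ_ : Poly → Seq → Set
d ∣ˢ φ = ∃ λ q → coeff (mulP d q) ≗ φ

module Divisible (d : Poly) where

  conv-quotient : ∀ q {φ} → coeff (mulP d q) ≗ φ → conv d (coeff q) ≗ φ
  conv-quotient q dq≗φ i = trans (sym (coeff-mulP d q i)) (dq≗φ i)

  ∣ˢ-intro : ∀ {φ} q → conv d (coeff q) ≗ φ → d ∣ˢ φ
  ∣ˢ-intro q dq≗φ = q , λ i → trans (coeff-mulP d q i) (dq≗φ i)

  ∣ˢ-resp-≗ : ∀ {φ ψ} → φ ≗ ψ → d ∣ˢ φ → d ∣ˢ ψ
  ∣ˢ-resp-≗ φ≗ψ (q , dq≗φ) = q , λ i → trans (dq≗φ i) (φ≗ψ i)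

  ∣ˢ-⊕ : ∀ {φ ψ} → d ∣ˢ φ → d ∣ˢ ψ → d ∣ˢ φ ⊕ ψ
  ∣ˢ-⊕ (q , dq≗φ) (r , dr≗ψ) = ∣ˢ-intro (addP q r) λ i →
    trans (conv-cong d (coeff-addP q r) i)
          (trans (conv-⊕ d (coeff q) (coeff r) i)
                 (⊕-cong (conv-quotient q dq≗φ) (conv-quotient r dr≗ψ) i))

  ∣ˢ-⊙ : ∀ {φ} c → d ∣ˢ φ → d ∣ˢ c ⊙ φ
  ∣ˢ-⊙ c (q , dq≗φ) = ∣ˢ-intro (scaleP c q) λ i →
    trans (conv-cong d (coeff-scaleP c q) i)
          (trans (conv-⊙ d c (coeff q) i) (cong (c *ℤ_) (conv-quotient q dq≗φ i)))

  ∣ˢ-shift : ∀ {φ} k → d ∣ˢ φ → d ∣ˢ shift k φ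
  ∣ˢ-shift k (q , dq≗φ) = ∣ˢ-intro (replicate k 0ℤ ++ q) λ i →
    trans (conv-cong d (coeff-zeros-++ k q) i)
          (trans (conv-shift d k (coeff q) i) (shift-cong k (conv-quotient q dq≗φ) i))

  ∣ˢ-cancelʳ : ∀ {φ ψ} → d ∣ˢ φ ⊕ ψ → d ∣ˢ ψ → d ∣ˢ φ
  ∣ˢ-cancelʳ {φ} {ψ} d∣φ⊕ψ d∣ψ =
    ∣ˢ-resp-≗ (λ i → cancel (φ i) (ψ i)) (∣ˢ-⊕ d∣φ⊕ψ (∣ˢ-⊙ -1ℤ d∣ψ))
    where
    cancel : ∀ x y → x +ℤ y +ℤ -1ℤ *ℤ y ≡ x
    cancel = solve-∀

coeffs : LP → Seq
coeffs f = coeff (toPoly f)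

coeffs-∨ : ∀ f g → coeffs (f ∨ g) ≗ coeffs f ⊕ shift (ℓ f) (coeffs g)
coeffs-∨ []      g i       = sym (ℤ.+-identityˡ _)
coeffs-∨ (x ∷ f) g zero    = sym (ℤ.+-identityʳ _)
coeffs-∨ (x ∷ f) g (suc i) = coeffs-∨ f g i

coeffs-∨₃ : ∀ p u k →
  coeffs (p ∨ u ∨ k) ≗ coeffs p ⊕ shift (ℓ p) (coeffs u ⊕ shift (ℓ u) (coeffs k))
coeffs-∨₃ p u k i =
  trans (coeffs-∨ p (u ∨ k) i) (cong (coeffs p i +ℤ_) (shift-cong (ℓ p) (coeffs-∨ u k) i))

∨-telescope : ∀ p u k →
  coeffs (p ∨ u ∨ u ∨ k) ⊕ shift (ℓ u) (coeffs (p ∨ k))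
    ≗ coeffs (p ∨ u ∨ k) ⊕ shift (ℓ u) (coeffs (p ∨ u ∨ k))
∨-telescope p u k i = begin
  (coeffs (p ∨ u ∨ u ∨ k) ⊕ shift e (coeffs (p ∨ k))) i
    ≡⟨ ⊕-cong expand (shift-cong e (coeffs-∨ p k)) i ⟩
  (P ⊕ shift a (U ⊕ shift e (U ⊕ shift e K)) ⊕ shift e (P ⊕ shift a K)) i
    ≡⟨ shift-telescope a e P U K i ⟩
  (P ⊕ shift a (U ⊕ shift e K) ⊕ shift e (P ⊕ shift a (U ⊕ shift e K))) i
    ≡⟨ ⊕-cong (coeffs-∨₃ p u k) (shift-cong e (coeffs-∨₃ p u k)) i ⟨
  (coeffs (p ∨ u ∨ k) ⊕ shift e (coeffs (p ∨ u ∨ k))) i ∎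
  where
  a = ℓ p
  e = ℓ u
  P = coeffs p
  U = coeffs u
  K = coeffs k
  expand : coeffs (p ∨ u ∨ u ∨ k) ≗ P ⊕ shift a (U ⊕ shift e (U ⊕ shift e K))
  expand j = trans (coeffs-∨ p (u ∨ u ∨ k) j) (cong (P j +ℤ_) (shift-cong a (coeffs-∨₃ u u k) j))

·-involutive : ∀ s f → s · s · f ≡ f
·-involutive s f = begin
  s · s · f                            ≡⟨ map-∘ f ⟨
  map (λ x → s Sign.* (s Sign.* x)) f  ≡⟨ map-cong square f ⟩
  map (λ x → x) f                      ≡⟨ map-id f ⟩
  f                                    ∎
  where
  square : ∀ x → s Sign.* (s Sign.* x) ≡ x
  square x = trans (sym (Sign.*-assoc s s x)) (cong (Sign._* x) (Sign.s*s≡+ s))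

·-rev-∨ : ∀ s f g → s · rev (f ∨ g) ≡ s · rev g ∨ s · rev f
·-rev-∨ s f g = trans (cong (s ·_) (reverse-++ f g)) (map-++ (s Sign.*_) (rev g) (rev f))

·-rev-involutive : ∀ s f → s · rev (s · rev f) ≡ f
·-rev-involutive s f = begin
  s · rev (s · rev f)   ≡⟨ cong (s ·_) (reverse-map (s Sign.*_) (rev f)) ⟨
  s · s · rev (rev f)   ≡⟨ ·-involutive s (rev (rev f)) ⟩
  rev (rev f)           ≡⟨ reverse-involutive f ⟩
  f                     ∎

Sym-∨ : ∀ s f g → Sym s (f ∨ g) ≡ f ∨ Sym s g ∨ s · rev f
Sym-∨ s f g = begin
  (f ∨ g) ∨ s · rev (f ∨ g)        ≡⟨ cong ((f ∨ g) ∨_) (·-rev-∨ s f g) ⟩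
  (f ∨ g) ∨ s · rev g ∨ s · rev f  ≡⟨ ++-assoc f g _ ⟩
  f ∨ g ∨ s · rev g ∨ s · rev f    ≡⟨ cong (f ∨_) (++-assoc g (s · rev g) (s · rev f)) ⟨
  f ∨ Sym s g ∨ s · rev f          ∎

·-rev-Sym : ∀ s f → s · rev (Sym s f) ≡ Sym s f
·-rev-Sym s f = trans (·-rev-∨ s f (s · rev f)) (cong (_∨ s · rev f) (·-rev-involutive s f))

Sym-∨-Sym : ∀ s f g → Sym s (f ∨ Sym s g) ≡ f ∨ Sym s g ∨ Sym s g ∨ s · rev f
Sym-∨-Sym s f g = begin
  Sym s (f ∨ u)                    ≡⟨ Sym-∨ s f u ⟩
  f ∨ (u ∨ s · rev u) ∨ s · rev f  ≡⟨ cong (λ h → f ∨ (u ∨ h) ∨ s · rev f) (·-rev-Sym s g) ⟩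
  f ∨ (u ∨ u) ∨ s · rev f          ≡⟨ cong (f ∨_) (++-assoc u u (s · rev f)) ⟩
  f ∨ u ∨ u ∨ s · rev f            ∎
  where
  u = Sym s g

Sym-telescope : ∀ s f g →
  coeffs (Sym s (f ∨ Sym s g)) ⊕ shift (ℓ (Sym s g)) (coeffs (Sym s f))
    ≗ coeffs (Sym s (f ∨ g)) ⊕ shift (ℓ (Sym s g)) (coeffs (Sym s (f ∨ g)))
Sym-telescope s f g rewrite Sym-∨-Sym s f g | Sym-∨ s f g = ∨-telescope f (Sym s g) (s · rev f)

ℓ-Sym : ∀ s f → ℓ (Sym s f) ≡ ℓ f + ℓ f
ℓ-Sym s f = begin
  ℓ (Sym s f)          ≡⟨ length-++ f ⟩
  ℓ f + ℓ (s · rev f)  ≡⟨ cong (ℓ f +_) (length-map (s Sign.*_) (rev f)) ⟩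
  ℓ f + ℓ (rev f)      ≡⟨ cong (ℓ f +_) (length-reverse f) ⟩
  ℓ f + ℓ f            ∎

ℓ-Sym-∨-Sym : ∀ s f g → ℓ (Sym s (f ∨ Sym s g)) ≡ 2 * ℓ f + 4 * ℓ g
ℓ-Sym-∨-Sym s f g = begin
  ℓ (Sym s (f ∨ Sym s g))                    ≡⟨ ℓ-Sym s (f ∨ Sym s g) ⟩
  ℓ (f ∨ Sym s g) + ℓ (f ∨ Sym s g)          ≡⟨ cong (λ x → x + x) (length-++ f) ⟩
  (ℓ f + ℓ (Sym s g)) + (ℓ f + ℓ (Sym s g))  ≡⟨ cong (λ x → (ℓ f + x) + (ℓ f + x)) (ℓ-Sym s g) ⟩
  (ℓ f + (ℓ g + ℓ g)) + (ℓ f + (ℓ g + ℓ g))  ≡⟨ collect (ℓ f) (ℓ g) ⟩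
  2 * ℓ f + 4 * ℓ g                          ∎
  where
  collect : ∀ n δ → (n + (δ + δ)) + (n + (δ + δ)) ≡ 2 * n + 4 * δ
  collect = ℕ-Solver.solve-∀

theorem6p1 : (m : ℕ) → m ≥ 1 → (s : Sign) → s ≡ negPow m →
    (n δ : ℕ) (f g : LP) → ℓ f ≡ n → ℓ g ≡ δ →
    Sym s f ∈𝒫[ 2 * n , m ] →
    Sym s (f ∨ g) ∈𝒫[ 2 * n + 2 * δ , m ] →
    Sym s (f ∨ g ∨ (s · rev g)) ∈𝒫[ 2 * n + 4 * δ , m ]
theorem6p1 m _ s _ n δ f g refl refl (_ , Sf-order) (_ , Sf₁-order) = ℓ-Sym-∨-Sym s f g , Sf₂-order
  where
  open Divisible (xm1pow m)
  e = ℓ (Sym s g)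
  Sf₂-order : HasOrder m (Sym s (f ∨ Sym s g))
  Sf₂-order = ∣ˢ-cancelʳ
    (∣ˢ-resp-≗ (sym ∘ Sym-telescope s f g) (∣ˢ-⊕ Sf₁-order (∣ˢ-shift e Sf₁-order)))
    (∣ˢ-shift e Sf-order)
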